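{- In a triangle-free graph $G$ (a graph with no $3$-cycles), a code $C\subseteq V(G)$ is a local locating-dominating code if and only if it is a covering code.
   Context: Graphs are simple and undirected. For a vertex $u$, $N[u]$ is its closed neighbourhood, and for a code (nonempty vertex subset) $C$, $I_C(u)=N[u]\cap C$. A code $C$ is a covering code if $I_C(u)\neq\emptyset$ for every vertex $u$. A code $C$ is a local locating-dominating code if it is a covering code and $I_C(u)\neq I_C(v)$ for every pair of adjacent vertices $u,v$ with $u,v\notin C$. -}

module Defs where

open import Data.Nat using (ℕ)
open import Data.Fin using (Fin)
open import Data.Fin.Subset using (Subset; _∈_; _∉_)
open import Data.Product using (Σ; _×_; ∃-syntax)
open import Data.Sum using (_⊎_)
open import Data.Empty using (⊥)
open import Relation.Nullary using (¬_)
open import Relation.Binary.PropositionalEquality using (_≡_)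
open import Function.Bundles using (_⇔_)

record SimpleGraph (n : ℕ) : Set₁ where
  field
    Adj     : Fin n → Fin n → Set
    sym     : ∀ {u v} → Adj u v → Adj v u
    irrefl  : ∀ {u} → ¬ Adj u u

open SimpleGraph public

InClosedNbhd : ∀ {n} → SimpleGraph n → Fin n → Fin n → Set
InClosedNbhd G u w = (w ≡ u) ⊎ Adj G u w

InI : ∀ {n} → SimpleGraph n → Subset n → Fin n → Fin n → Set
InI G C u w = InClosedNbhd G u w × (w ∈ C)

IsCode : ∀ {n} → Subset n → Set
IsCode C = ∃[ c ] (c ∈ C)

TriangleFree : ∀ {n} → SimpleGraph n → Set
TriangleFree G = ∀ u v w → Adj G u v → Adj G v w → Adj G u w → ⊥

IsCovering : ∀ {n} → SimpleGraph n → Subset n → Set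
IsCovering G C = ∀ u → ∃[ w ] InI G C u w

SameI : ∀ {n} → SimpleGraph n → Subset n → Fin n → Fin n → Set
SameI G C u v = ∀ w → InI G C u w ⇔ InI G C v w

IsLocalLD : ∀ {n} → SimpleGraph n → Subset n → Set
IsLocalLD G C = IsCovering G C ×
  (∀ u v → Adj G u v → u ∉ C → v ∉ C → ¬ SameI G C u v)

{-# OPTIONS --safe #-}
module Submission where

open import Defs
open import Data.Fin.Subset using (Subset; _∉_)
open import Data.Product using (∃-syntax; _,_; proj₁)
open import Data.Sum using (inj₁; inj₂)
open import Function.Bundles using (_⇔_; mk⇔; Equivalence)
open import Relation.Nullary using (¬_)
open import Relation.Binary.PropositionalEquality using (refl)

-- A codeword w dominating u lies outside u and v, so it is a common
-- neighbour of the adjacent vertices u and v, closing a triangle.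
triangleFree⇒adjacent-noncodewords-separated :
  ∀ {n} (G : SimpleGraph n) → TriangleFree G → (C : Subset n) →
  ∀ {u v} → Adj G u v → u ∉ C → v ∉ C →
  ∃[ w ] InI G C u w → ¬ SameI G C u v
triangleFree⇒adjacent-noncodewords-separated G tf C uv u∉C v∉C (w , inj₁ refl , w∈C) same =
  u∉C w∈C
triangleFree⇒adjacent-noncodewords-separated G tf C {u} {v} uv u∉C v∉C (w , inj₂ uw , w∈C) same
  with Equivalence.to (same w) (inj₂ uw , w∈C)
... | inj₁ refl , _ = v∉C w∈C
... | inj₂ vw , _ = tf u v w uv vw uw

mainTheorem11 : ∀ {n} (G : SimpleGraph n) → TriangleFree G →
    (C : Subset n) → IsCode C → (IsLocalLD G C ⇔ IsCovering G C)
mainTheorem11 G tf C _ = mk⇔ proj₁ λ cov →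
  cov , λ u v uv u∉C v∉C →
    triangleFree⇒adjacent-noncodewords-separated G tf C uv u∉C v∉C (cov u)
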